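{- Let $k\ge 4$ and let $S$ be an $n$-term graphical sequence. Suppose $S$ has a realization $G$ (a simple graph) containing a cycle $C$ of length $k$, and suppose there exist a vertex $x$ of $G$ not on $C$ with $d_G(x)\ge \lfloor k/2\rfloor+1$ and a vertex $w$ on $C$ with $d_G(w)\ge 3$. Then $S$ has a realization containing a cycle of length $k+1$ as a subgraph.
   Context: A sequence $S=(d_1,\dots,d_n)$ of non-negative integers is graphical if there is a simple graph on $n$ vertices $v_1,\dots,v_n$ with $d(v_i)=d_i$ for all $i$; such a graph is a realization of $S$. $\lfloor x\rfloor$ denotes the largest integer at most $x$. "Containing a cycle" means containing it as a (not necessarily induced) subgraph. -}

module Defs where

open import Data.Nat using (ℕ; zero; suc; _+_; _≤_; _/_)
open import Data.Bool using (Bool; true; false)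
open import Data.Fin using (Fin; toℕ; fromℕ<)
open import Data.Fin.Properties using ()
open import Data.List using (List; length; filter)
open import Data.List using () renaming (allFin to allFinL)
open import Data.Sum using (_⊎_)
open import Data.Product using (Σ; _×_; _,_; ∃)
open import Data.Nat.Properties using ()
open import Data.Bool.Properties using ()
open import Relation.Binary.PropositionalEquality using (_≡_; _≢_)
open import Relation.Nullary using (¬_)
open import Function.Definitions using (Injective)
open import Relation.Nullary.Decidable using ()
open import Data.Bool using (T?)

record Graph (n : ℕ) : Set where
  field
    adj   : Fin n → Fin n → Bool
    sym   : ∀ u v → adj u v ≡ adj v u
    irrefl : ∀ v → adj v v ≡ false
open Graph public

degree : ∀ {n} → Graph n → Fin n → ℕ
degree {n} G v = length (filter (λ u → T? (adj G v u)) (allFinL n))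

Realizes : ∀ {n} → Graph n → (Fin n → ℕ) → Set
Realizes G S = ∀ v → degree G v ≡ S v

CycSucc : ∀ {k} → Fin k → Fin k → Set
CycSucc {k} i j = (toℕ j ≡ suc (toℕ i)) ⊎ (suc (toℕ i) ≡ k × toℕ j ≡ 0)

record Cycle {n} (G : Graph n) (k : ℕ) : Set where
  field
    len≥3 : 3 ≤ k
    vtx   : Fin k → Fin n
    inj   : Injective _≡_ _≡_ vtx
    edges : ∀ (i j : Fin k) → CycSucc i j → adj G (vtx i) (vtx j) ≡ true
open Cycle public

OnCycle : ∀ {n} {G : Graph n} {k} → Cycle G k → Fin n → Set
OnCycle C x = ∃ λ i → vtx C i ≡ x

module Submission where

open import Defs
open import Data.Nat using (ℕ; suc; _+_; _≤_; _/_)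
open import Data.Fin using (Fin)
open import Data.Product using (Σ; _×_; ∃)
open import Relation.Nullary using (¬_)

open import Data.Bool using (Bool; true; false; _∧_; _∨_; not; if_then_else_; T?)
open import Data.Bool.Properties using (∨-comm; ∧-comm; ∨-zeroʳ; ∧-zeroʳ; ∧-distribˡ-∨) renaming (_≟_ to _≟ᵇ_)
open import Data.Empty using (⊥; ⊥-elim)
open import Data.Fin using (zero; suc; toℕ; fromℕ; inject₁; _≟_)
open import Data.Fin.Properties
  using (any?; fromℕ≢inject₁; inject₁-injective; toℕ-injective; toℕ-fromℕ; toℕ-inject₁; toℕ<n)
  renaming (suc-injective to Fin-suc-injective)
open import Data.Fin.Relation.Unary.Top using (View; view; ‵fromℕ; ‵inj₁; view-fromℕ; view-inject₁)
open import Data.List using (length; filter; tabulate)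
open import Data.Nat using (zero; _*_; _<_; _%_; z≤n; s≤s)
open import Data.Nat.DivMod using (m≡m%n+[m/n]*n; m%n<n; /-monoˡ-≤)
open import Data.Nat.GeneralisedArithmetic using (iterate)
open import Data.Nat.Properties
  using (≤-refl; ≤-reflexive; ≤-trans; ≤-pred; <-irrefl; <⇒≱; m≤m+n; m≤n⇒m≤1+n; suc-injective; +-suc; +-assoc; +-comm
        ; +-identityʳ; +-mono-≤; +-monoˡ-≤; +-monoʳ-≤; +-cancelʳ-≡; +-cancelˡ-≤; +-cancelʳ-≤; +-commutativeSemigroup
        ; module ≤-Reasoning)
open import Data.Nat.Tactic.RingSolver using (solve-∀)
open import Algebra.Properties.CommutativeSemigroup +-commutativeSemigroup
  using () renaming (interchange to +-interchange)
open import Data.Product using (_,_)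
open import Data.Sum using (_⊎_; inj₁; inj₂)
open import Data.Vec.Functional using (updateAt)
open import Data.Vec.Functional.Properties using (updateAt-updates; updateAt-minimal)
open import Function using (_∘_; const)
open import Relation.Binary.PropositionalEquality
  using (_≡_; _≢_; refl; cong; cong₂; subst; trans; module ≡-Reasoning)
  renaming (sym to ≡-sym)
open import Relation.Nullary using (Dec; yes; no; does; contradiction)
open import Relation.Nullary.Decidable using (dec-true; _×-dec_; ¬?)

-- A 2-switch, trading edges ab, cd for non-edges ac, bd, preserves all degrees, so it maps
-- realizations of S to realizations of S. A (k+1)-cycle arises by
-- inserting a vertex off C between two consecutive vertices of C, or by replacing one vertex of C
-- by two adjacent vertices off C; the missing edges are created by at most two 2-switches that keep
-- the rest of C. If x has a neighbour on C, either one of these constructions applies, or the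
-- neighbours of x on C are pairwise non-consecutive and x has no neighbour off C, or they are
-- pairwise at cyclic distance at least 3 and x has at most one neighbour off C; in both cases
-- counting gives d(x) ≤ ⌊k/2⌋. If x has no neighbour on C, either a neighbour of x adjacent to C
-- is inserted, or a neighbour z of w not next to w on C (it exists as d(w) ≥ 3) lets a 2-switch
-- make x adjacent to w.

indicator : Bool → ℕ
indicator true  = 1
indicator false = 0

count : ∀ {n} → (Fin n → Bool) → ℕ
count {zero}  f = 0
count {suc n} f = indicator (f zero) + count (f ∘ suc)


count-cong : ∀ {n} {f g : Fin n → Bool} → (∀ i → f i ≡ g i) → count f ≡ count g
count-cong {zero}  f≗g = refl
count-cong {suc n} f≗g = cong₂ _+_ (cong indicator (f≗g zero)) (count-cong (f≗g ∘ suc))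

count-mono : ∀ {n} {f g : Fin n → Bool} → (∀ i → f i ≡ true → g i ≡ true) → count f ≤ count g
count-mono {zero}  f⊆g = z≤n
count-mono {suc n} {f} {g} f⊆g = +-mono-≤ (indicator-mono (f zero) (g zero) (f⊆g zero)) (count-mono (f⊆g ∘ suc))
  where
  indicator-mono : ∀ a b → (a ≡ true → b ≡ true) → indicator a ≤ indicator b
  indicator-mono true  b a⇒b rewrite a⇒b refl = ≤-refl
  indicator-mono false b a⇒b = z≤n

count-false : ∀ {n} {f : Fin n → Bool} → (∀ i → f i ≡ false) → count f ≡ 0
count-false {zero}  f≗false = refl
count-false {suc n} f≗false rewrite f≗false zero = count-false (f≗false ∘ suc)

indicator≤1 : ∀ b → indicator b ≤ 1
indicator≤1 true  = ≤-refl
indicator≤1 false = z≤n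

count≤n : ∀ {n} (f : Fin n → Bool) → count f ≤ n
count≤n {zero}  f = z≤n
count≤n {suc n} f = +-mono-≤ (indicator≤1 (f zero)) (count≤n (f ∘ suc))

count-∨ : ∀ {n} (f g : Fin n → Bool) → count (λ i → f i ∨ g i) ≤ count f + count g
count-∨ {zero}  f g = z≤n
count-∨ {suc n} f g = begin
  indicator (f zero ∨ g zero) + count (λ i → f (suc i) ∨ g (suc i))
    ≤⟨ +-mono-≤ (indicator-∨ (f zero) (g zero)) (count-∨ (f ∘ suc) (g ∘ suc)) ⟩
  (indicator (f zero) + indicator (g zero)) + (count (f ∘ suc) + count (g ∘ suc))
    ≡⟨ +-interchange (indicator (f zero)) _ _ _ ⟩
  count f + count g ∎
  where
  open ≤-Reasoning
  indicator-∨ : ∀ a b → indicator (a ∨ b) ≤ indicator a + indicator b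
  indicator-∨ true  b = s≤s z≤n
  indicator-∨ false b = ≤-refl

count-∨-disjoint : ∀ {n} (f g : Fin n → Bool) → (∀ i → f i ≡ true → g i ≡ false) →
                   count (λ i → f i ∨ g i) ≡ count f + count g
count-∨-disjoint {zero}  f g disj = refl
count-∨-disjoint {suc n} f g disj = begin
  indicator (f zero ∨ g zero) + count (λ i → f (suc i) ∨ g (suc i))
    ≡⟨ cong₂ _+_ (indicator-∨ (f zero) (g zero) (disj zero)) (count-∨-disjoint (f ∘ suc) (g ∘ suc) (disj ∘ suc)) ⟩
  (indicator (f zero) + indicator (g zero)) + (count (f ∘ suc) + count (g ∘ suc))
    ≡⟨ +-interchange (indicator (f zero)) _ _ _ ⟩
  count f + count g ∎
  where
  open ≡-Reasoning
  indicator-∨ : ∀ a b → (a ≡ true → b ≡ false) → indicator (a ∨ b) ≡ indicator a + indicator b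
  indicator-∨ true  b a⇒¬b rewrite a⇒¬b refl = refl
  indicator-∨ false b _ = refl

count-disjoint : ∀ {n} (f g : Fin n → Bool) → (∀ i → f i ≡ true → g i ≡ false) → count f + count g ≤ n
count-disjoint {n} f g disj = subst (_≤ n) (count-∨-disjoint f g disj) (count≤n (λ i → f i ∨ g i))

count-at-most-one : ∀ {n} {f : Fin n → Bool} (a : Fin n) → (∀ u → f u ≡ true → u ≡ a) → count f ≤ 1
count-at-most-one {suc n} {f} zero only-a = begin
  indicator (f zero) + count (f ∘ suc) ≡⟨ cong (indicator (f zero) +_) (count-false f∘suc≗false) ⟩
  indicator (f zero) + 0               ≡⟨ +-identityʳ _ ⟩
  indicator (f zero)                   ≤⟨ indicator≤1 (f zero) ⟩
  1 ∎
  where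
  open ≤-Reasoning
  f∘suc≗false : ∀ i → f (suc i) ≡ false
  f∘suc≗false i with f (suc i) in fi
  ... | true  with () ← only-a (suc i) fi
  ... | false = refl
count-at-most-one {suc n} {f} (suc a) only-a with f zero in f0
... | true  with () ← only-a zero f0
... | false = count-at-most-one a λ u fu → Fin-suc-injective (only-a (suc u) fu)

count-updateAt : ∀ {n} (f : Fin n → Bool) (a : Fin n) (b : Bool) →
                 count (updateAt f a (const b)) + indicator (f a) ≡ count f + indicator b
count-updateAt {suc n} f zero b = rotate₃ (indicator b) (count (f ∘ suc)) (indicator (f zero))
  where
  rotate₃ : ∀ x y z → (x + y) + z ≡ (z + y) + x
  rotate₃ = solve-∀
count-updateAt {suc n} f (suc a) b = begin
  (indicator (f zero) + count (updateAt (f ∘ suc) a (const b))) + indicator (f (suc a))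
    ≡⟨ +-assoc (indicator (f zero)) _ _ ⟩
  indicator (f zero) + (count (updateAt (f ∘ suc) a (const b)) + indicator (f (suc a)))
    ≡⟨ cong (indicator (f zero) +_) (count-updateAt (f ∘ suc) a b) ⟩
  indicator (f zero) + (count (f ∘ suc) + indicator b)
    ≡⟨ +-assoc (indicator (f zero)) _ _ ⟨
  count f + indicator b ∎
  where open ≡-Reasoning

count-exchange : ∀ {n} {f g : Fin n → Bool} {p q : Fin n} → q ≢ p →
                 f p ≡ true → f q ≡ false → g p ≡ false → g q ≡ true →
                 (∀ u → u ≢ p → u ≢ q → f u ≡ g u) → count f ≡ count g
count-exchange {f = f} {g} {p} {q} q≢p fp fq gp gq elsewhere = +-cancelʳ-≡ 0 _ _ (begin
  count f + 0                                   ≡⟨ count-updateAt f p false ⟨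
  count h + indicator (f p)                     ≡⟨ cong (λ b → count h + indicator b) fp ⟩
  count h + 1                                   ≡⟨ count-updateAt h q true ⟨
  count (updateAt h q (const true)) + indicator (h q)
    ≡⟨ cong₂ _+_ (count-cong h′≗g) (cong indicator (trans (updateAt-minimal q p f q≢p) fq)) ⟩
  count g + 0 ∎)
  where
  open ≡-Reasoning
  h : Fin _ → Bool
  h = updateAt f p (const false)
  h′≗g : ∀ u → updateAt h q (const true) u ≡ g u
  h′≗g u with u ≟ q | u ≟ p
  ... | yes refl | _        = trans (updateAt-updates q h) (≡-sym gq)
  ... | no u≢q   | yes refl = trans (updateAt-minimal u q h u≢q) (trans (updateAt-updates p f) (≡-sym gp))
  ... | no u≢q   | no u≢p   = trans (updateAt-minimal u q h u≢q) (trans (updateAt-minimal u p f u≢p) (elsewhere u u≢p u≢q))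

length-filter-tabulate : ∀ {m n} (g : Fin m → Bool) (f : Fin n → Fin m) →
                         length (filter (T? ∘ g) (tabulate f)) ≡ count (g ∘ f)
length-filter-tabulate {n = zero}  g f = refl
length-filter-tabulate {n = suc n} g f with g (f zero)
... | true  = cong suc (length-filter-tabulate g (f ∘ suc))
... | false = length-filter-tabulate g (f ∘ suc)

degree≡count : ∀ {n} (G : Graph n) (v : Fin n) → degree G v ≡ count (adj G v)
degree≡count G v = length-filter-tabulate (adj G v) (λ u → u)

_==_ : ∀ {n} → Fin n → Fin n → Bool
a == b = does (a ≟ b)

==-refl : ∀ {n} (a : Fin n) → (a == a) ≡ true
==-refl a = dec-true (a ≟ a) refl

==⇒≡ : ∀ {n} (a b : Fin n) → (a == b) ≡ true → a ≡ b
==⇒≡ a b eq with a ≟ b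
... | yes a≡b = a≡b

inImage : ∀ {k n} → (Fin k → Fin n) → Fin n → Bool
inImage v u = does (any? λ i → v i ≟ u)

count-∧-== : ∀ {n} (g : Fin n → Bool) (a : Fin n) → count (λ u → g u ∧ (a == u)) ≤ indicator (g a)
count-∧-== g a with g a in ga
... | true  = count-at-most-one a only-a
  where
  only-a : ∀ u → (g u ∧ (a == u)) ≡ true → u ≡ a
  only-a u gu∧a≡u with g u | a == u in a=u
  only-a u refl | true | true = ≡-sym (==⇒≡ a u a=u)
... | false = ≤-reflexive (count-false not-a)
  where
  not-a : ∀ u → (g u ∧ (a == u)) ≡ false
  not-a u with a ≟ u
  ... | no _     = ∧-zeroʳ (g u)
  ... | yes refl rewrite ga = refl

count-image : ∀ {k n} (g : Fin n → Bool) (v : Fin k → Fin n) →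
              count (λ u → g u ∧ inImage v u) ≤ count (g ∘ v)
count-image {zero}  g v = ≤-reflexive (count-false λ u → ∧-zeroʳ (g u))
count-image {suc k} g v = begin
  count (λ u → g u ∧ inImage v u)
    ≡⟨ count-cong (λ u → ∧-distribˡ-∨ (g u) (v zero == u) _) ⟩
  count (λ u → (g u ∧ (v zero == u)) ∨ (g u ∧ inImage (v ∘ suc) u))
    ≤⟨ count-∨ (λ u → g u ∧ (v zero == u)) (λ u → g u ∧ inImage (v ∘ suc) u) ⟩
  count (λ u → g u ∧ (v zero == u)) + count (λ u → g u ∧ inImage (v ∘ suc) u)
    ≤⟨ +-mono-≤ (count-∧-== g (v zero)) (count-image g (v ∘ suc)) ⟩
  count (g ∘ v) ∎
  where open ≤-Reasoning

count≤2 : ∀ {n} {f : Fin n → Bool} (a b : Fin n) → (∀ u → f u ≡ true → u ≡ a ⊎ u ≡ b) → count f ≤ 2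
count≤2 {f = f} a b only-ab = begin
  count f                                ≤⟨ count-mono f⊆ab ⟩
  count (λ u → (u == a) ∨ (u == b))      ≤⟨ count-∨ (_== a) (_== b) ⟩
  count (_== a) + count (_== b)          ≤⟨ +-mono-≤ (count-at-most-one a (λ u → ==⇒≡ u a))
                                                      (count-at-most-one b (λ u → ==⇒≡ u b)) ⟩
  2 ∎
  where
  open ≤-Reasoning
  f⊆ab : ∀ u → f u ≡ true → ((u == a) ∨ (u == b)) ≡ true
  f⊆ab u fu with only-ab u fu
  ... | inj₁ refl rewrite ==-refl u = refl
  ... | inj₂ refl rewrite ==-refl u = ∨-zeroʳ (u == a)

-- The cyclic successor on Fin (suc m)

next : ∀ {m} → Fin (suc m) → Fin (suc m)
next i = next-view (view i)
  where
  next-view : ∀ {m} {i : Fin (suc m)} → View i → Fin (suc m)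
  next-view ‵fromℕ           = zero
  next-view (‵inj₁ {i = j} _) = suc j

next-fromℕ : ∀ m → next (fromℕ m) ≡ zero
next-fromℕ m rewrite view-fromℕ m = refl

next-inject₁ : ∀ {m} (j : Fin m) → next (inject₁ j) ≡ suc j
next-inject₁ j rewrite view-inject₁ j = refl

next-injective : ∀ {m} {i j : Fin (suc m)} → next i ≡ next j → i ≡ j
next-injective {i = i} {j} eq with view i | view j
next-injective ()   | ‵fromℕ | ‵inj₁ _
next-injective ()   | ‵inj₁ _ | ‵fromℕ
next-injective refl | ‵fromℕ | ‵fromℕ = refl
next-injective refl | ‵inj₁ _ | ‵inj₁ _ = refl

toℕ-next : ∀ {m} (i : Fin (suc m)) → toℕ i < m → toℕ (next i) ≡ suc (toℕ i)
toℕ-next i i<m with view i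
toℕ-next .(fromℕ m)   i<m | ‵fromℕ {n = m}  = ⊥-elim (<-irrefl (toℕ-fromℕ m) i<m)
toℕ-next .(inject₁ j) i<m | ‵inj₁ {i = j} _ = cong suc (≡-sym (toℕ-inject₁ j))

CycSucc-next : ∀ {m} (i : Fin (suc m)) → CycSucc i (next i)
CycSucc-next i with view i
CycSucc-next .(fromℕ m)   | ‵fromℕ {n = m}  = inj₂ (cong suc (toℕ-fromℕ m) , refl)
CycSucc-next .(inject₁ j) | ‵inj₁ {i = j} _ = inj₁ (cong suc (≡-sym (toℕ-inject₁ j)))

CycSucc⇒next : ∀ {m} {i j : Fin (suc m)} → CycSucc i j → j ≡ next i
CycSucc⇒next {i = i} {j} i→j with view i
CycSucc⇒next {j = j}    (inj₁ j≡1+m)      | ‵fromℕ {n = m}  =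
  ⊥-elim (<-irrefl (trans j≡1+m (cong suc (toℕ-fromℕ m))) (toℕ<n j))
CycSucc⇒next {j = zero} (inj₂ _)          | ‵fromℕ {n = m}  = refl
CycSucc⇒next {j = j}    (inj₁ j≡1+i)      | ‵inj₁ {i = i} _ =
  toℕ-injective (trans j≡1+i (cong suc (toℕ-inject₁ i)))
CycSucc⇒next            (inj₂ (1+i≡k , _)) | ‵inj₁ {i = i} _ =
  ⊥-elim (<-irrefl (trans (≡-sym (toℕ-inject₁ i)) (suc-injective 1+i≡k)) (toℕ<n i))

count-snoc : ∀ {m} (f : Fin (suc m) → Bool) → count f ≡ count (f ∘ inject₁) + indicator (f (fromℕ m))
count-snoc {zero}  f = +-comm (indicator (f zero)) 0
count-snoc {suc m} f = begin
  indicator (f zero) + count (f ∘ suc)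
    ≡⟨ cong (indicator (f zero) +_) (count-snoc (f ∘ suc)) ⟩
  indicator (f zero) + (count (f ∘ suc ∘ inject₁) + indicator (f (fromℕ (suc m))))
    ≡⟨ +-assoc (indicator (f zero)) _ _ ⟨
  count (f ∘ inject₁) + indicator (f (fromℕ (suc m))) ∎
  where open ≡-Reasoning

count-next : ∀ {m} (f : Fin (suc m) → Bool) → count (f ∘ next) ≡ count f
count-next {m} f = begin
  count (f ∘ next)                                          ≡⟨ count-snoc (f ∘ next) ⟩
  count (f ∘ next ∘ inject₁) + indicator (f (next (fromℕ m))) ≡⟨ cong₂ _+_ (count-cong (cong f ∘ next-inject₁))
                                                                        (cong (indicator ∘ f) (next-fromℕ m)) ⟩
  count (f ∘ suc) + indicator (f zero)                      ≡⟨ +-comm _ (indicator (f zero)) ⟩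
  count f ∎
  where open ≡-Reasoning

count-independent : ∀ {m} (f : Fin (suc m) → Bool) → (∀ i → f i ≡ true → f (next i) ≡ false) →
                    count f + count f ≤ suc m
count-independent {m} f gap = subst (λ t → count f + t ≤ suc m) (count-next f) (count-disjoint f (f ∘ next) gap)

count-2-independent : ∀ {m} (f : Fin (suc m) → Bool) → (∀ i → f i ≡ true → f (next i) ≡ false) →
                      (∀ i → f i ≡ true → f (next (next i)) ≡ false) → count f + count f + count f ≤ suc m
count-2-independent {m} f gap₁ gap₂ = begin
  count f + count f + count f
    ≡⟨ +-assoc (count f) _ _ ⟩
  count f + (count f + count f)
    ≡⟨ cong (count f +_) (cong₂ _+_ (count-next f) shift₂) ⟨
  count f + (count (f ∘ next) + count (f ∘ next ∘ next))
    ≡⟨ cong (count f +_) (count-∨-disjoint (f ∘ next) (f ∘ next ∘ next) (gap₁ ∘ next)) ⟨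
  count f + count (λ i → f (next i) ∨ f (next (next i)))
    ≤⟨ count-disjoint f _ (λ i fi → cong₂ _∨_ (gap₁ i fi) (gap₂ i fi)) ⟩
  suc m ∎
  where
  open ≤-Reasoning
  shift₂ : count (f ∘ next ∘ next) ≡ count f
  shift₂ = trans (count-next (f ∘ next)) (count-next f)

shift : ∀ {m} → Fin (suc m) → Fin (suc m) → Fin (suc m)
shift r p = iterate next p (toℕ r)

iterate-next-comm : ∀ {m} (p : Fin (suc m)) t → iterate next (next p) t ≡ next (iterate next p t)
iterate-next-comm p zero    = refl
iterate-next-comm p (suc t) = iterate-next-comm (next p) t

iterate-next-injective : ∀ {m} {p q : Fin (suc m)} t → iterate next p t ≡ iterate next q t → p ≡ q
iterate-next-injective zero    eq = eq
iterate-next-injective (suc t) eq = next-injective (iterate-next-injective t eq)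

toℕ-iterate-next : ∀ {m} (p : Fin (suc m)) t → toℕ p + t ≤ m → toℕ (iterate next p t) ≡ toℕ p + t
toℕ-iterate-next p zero    _     = ≡-sym (+-identityʳ (toℕ p))
toℕ-iterate-next {m} p (suc t) p+1+t≤m = begin
  toℕ (iterate next (next p) t) ≡⟨ toℕ-iterate-next (next p) t (subst (_≤ m) (cong (_+ t) (≡-sym 1+p≡)) p+1+t≤) ⟩
  toℕ (next p) + t              ≡⟨ cong (_+ t) 1+p≡ ⟩
  suc (toℕ p) + t               ≡⟨ +-suc (toℕ p) t ⟨
  toℕ p + suc t ∎
  where
  open ≡-Reasoning
  p+1+t≤ : suc (toℕ p) + t ≤ m
  p+1+t≤ = subst (_≤ m) (+-suc (toℕ p) t) p+1+t≤m
  1+p≡ : toℕ (next p) ≡ suc (toℕ p)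
  1+p≡ = toℕ-next p (≤-trans (s≤s (m≤m+n (toℕ p) t)) p+1+t≤)

shift-zero : ∀ {m} (r : Fin (suc m)) → shift r zero ≡ r
shift-zero r = toℕ-injective (toℕ-iterate-next zero (toℕ r) (≤-pred (toℕ<n r)))

shift-next : ∀ {m} (r p : Fin (suc m)) → shift r (next p) ≡ next (shift r p)
shift-next r p = iterate-next-comm p (toℕ r)

shift-injective : ∀ {m} (r : Fin (suc m)) {p q} → shift r p ≡ shift r q → p ≡ q
shift-injective r = iterate-next-injective (toℕ r)

shift-fromℕ : ∀ {m} (i : Fin (suc m)) → shift (next i) (fromℕ m) ≡ i
shift-fromℕ {m} i = next-injective (begin
  next (shift (next i) (fromℕ m)) ≡⟨ shift-next (next i) (fromℕ m) ⟨
  shift (next i) (next (fromℕ m)) ≡⟨ cong (shift (next i)) (next-fromℕ m) ⟩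
  shift (next i) zero             ≡⟨ shift-zero (next i) ⟩
  next i ∎)
  where open ≡-Reasoning

shift-inject₁-fromℕ : ∀ {m} (i : Fin (suc (suc m))) → shift (next (next i)) (inject₁ (fromℕ m)) ≡ i
shift-inject₁-fromℕ {m} i = next-injective (begin
  next (shift (next (next i)) (inject₁ (fromℕ m))) ≡⟨ shift-next (next (next i)) (inject₁ (fromℕ m)) ⟨
  shift (next (next i)) (next (inject₁ (fromℕ m))) ≡⟨ cong (shift (next (next i))) (next-inject₁ (fromℕ m)) ⟩
  shift (next (next i)) (fromℕ (suc m))            ≡⟨ shift-fromℕ (next i) ⟩
  next i ∎)
  where open ≡-Reasoning

Edge NonEdge : ∀ {n} → Graph n → Fin n → Fin n → Set
Edge    G u v = adj G u v ≡ true
NonEdge G u v = adj G u v ≡ false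

module _ {n} (G : Graph n) {u v : Fin n} where

  edge-sym : Edge G u v → Edge G v u
  edge-sym uv = trans (Graph.sym G v u) uv

  nonEdge-sym : NonEdge G u v → NonEdge G v u
  nonEdge-sym uv = trans (Graph.sym G v u) uv

  edge⇒≢ : Edge G u v → u ≢ v
  edge⇒≢ uv refl with () ← trans (≡-sym (Graph.irrefl G u)) uv

  ¬edge⇒nonEdge : ¬ Edge G u v → NonEdge G u v
  ¬edge⇒nonEdge ¬uv with adj G u v
  ... | true  = ⊥-elim (¬uv refl)
  ... | false = refl

record Path {n} (G : Graph n) (ℓ : ℕ) : Set where
  field
    vertex           : Fin ℓ → Fin n
    vertex-injective : ∀ {i j} → vertex i ≡ vertex j → i ≡ j
    step             : ∀ i j → toℕ j ≡ suc (toℕ i) → Edge G (vertex i) (vertex j)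
open Path

NotOnPath : ∀ {n} {G : Graph n} {ℓ} → Path G ℓ → Fin n → Set
NotOnPath P v = ∀ i → vertex P i ≢ v

cycle⇒path : ∀ {n} {G : Graph n} {k} → Cycle G k → Path G k
cycle⇒path C = record { vertex = vtx C ; vertex-injective = inj C ; step = λ i j → edges C i j ∘ inj₁ }

dropLast : ∀ {n} {G : Graph n} {ℓ} → Path G (suc ℓ) → Path G ℓ
dropLast P = record
  { vertex           = vertex P ∘ inject₁
  ; vertex-injective = inject₁-injective ∘ vertex-injective P
  ; step             = λ i j j≡1+i → step P (inject₁ i) (inject₁ j)
                         (trans (toℕ-inject₁ j) (trans j≡1+i (cong suc (≡-sym (toℕ-inject₁ i)))))
  }

prepend : ∀ {n} {G : Graph n} {ℓ} (v : Fin n) (P : Path G (suc ℓ)) →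
          NotOnPath P v → Edge G v (vertex P zero) → Path G (suc (suc ℓ))
prepend {n} {G} {ℓ} v P v∉P v~P₀ = record { vertex = vertex′ ; vertex-injective = injective ; step = step′ }
  where
  vertex′ : Fin (suc (suc ℓ)) → Fin n
  vertex′ zero    = v
  vertex′ (suc i) = vertex P i
  injective : ∀ {i j} → vertex′ i ≡ vertex′ j → i ≡ j
  injective {zero}  {zero}  _  = refl
  injective {zero}  {suc j} eq = ⊥-elim (v∉P j (≡-sym eq))
  injective {suc i} {zero}  eq = ⊥-elim (v∉P i eq)
  injective {suc i} {suc j} eq = cong suc (vertex-injective P eq)
  step′ : ∀ i j → toℕ j ≡ suc (toℕ i) → Edge G (vertex′ i) (vertex′ j)
  step′ zero    (suc zero) _     = v~P₀
  step′ (suc i) (suc j)    j≡1+i = step P i j (suc-injective j≡1+i)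

close : ∀ {n} {G : Graph n} {m} (P : Path G (suc m)) → 3 ≤ suc m →
        Edge G (vertex P (fromℕ m)) (vertex P zero) → Cycle G (suc m)
close {G = G} {m} P 3≤ last~first = record
  { len≥3 = 3≤ ; vtx = vertex P ; inj = vertex-injective P ; edges = edges′ }
  where
  edges′ : ∀ i j → CycSucc i j → Edge G (vertex P i) (vertex P j)
  edges′ i j (inj₁ j≡1+i) = step P i j j≡1+i
  edges′ i j (inj₂ (1+i≡1+m , j≡0))
    with refl ← toℕ-injective {i = i} {fromℕ m} (trans (suc-injective 1+i≡1+m) (≡-sym (toℕ-fromℕ m)))
       | refl ← toℕ-injective {i = j} {zero} j≡0 = last~first

rotate : ∀ {n} {G : Graph n} {m} → Cycle G (suc m) → Fin (suc m) → Cycle G (suc m)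
rotate {G = G} C r = record
  { len≥3 = len≥3 C ; vtx = vtx C ∘ shift r ; inj = shift-injective r ∘ inj C ; edges = edges′ }
  where
  edges′ : ∀ i j → CycSucc i j → Edge G (vtx C (shift r i)) (vtx C (shift r j))
  edges′ i j i→j rewrite CycSucc⇒next i→j | shift-next r i = edges C _ _ (CycSucc-next (shift r i))

¬OnCycle-rotate : ∀ {n} {G : Graph n} {m} (C : Cycle G (suc m)) r {v} → ¬ OnCycle C v → ¬ OnCycle (rotate C r) v
¬OnCycle-rotate C r v∉C (i , eq) = v∉C (shift r i , eq)

module _ {n} {G : Graph n} {m} (C : Cycle G (suc m)) where

  first-rotate : ∀ r → vtx (rotate C r) zero ≡ vtx C r
  first-rotate r = cong (vtx C) (shift-zero r)

  last-rotate-next : ∀ i → vtx (rotate C (next i)) (fromℕ m) ≡ vtx C i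
  last-rotate-next i = cong (vtx C) (shift-fromℕ i)

penultimate-rotate-next² : ∀ {n} {G : Graph n} {m} (C : Cycle G (suc (suc m))) i →
                           vtx (rotate C (next (next i))) (inject₁ (fromℕ m)) ≡ vtx C i
penultimate-rotate-next² C i = cong (vtx C) (shift-inject₁-fromℕ i)

insertVertex : ∀ {n} {G : Graph n} {m} (P : Path G (suc m)) {v} → 3 ≤ suc (suc m) → NotOnPath P v →
               Edge G v (vertex P zero) → Edge G (vertex P (fromℕ m)) v → Cycle G (suc (suc m))
insertVertex P 3≤ v∉P v~first last~v = close (prepend _ P v∉P v~first) 3≤ last~v

insertTwoVertices : ∀ {n} {G : Graph n} {m} (P : Path G (suc m)) {x y} → NotOnPath P x → NotOnPath P y → x ≢ y →
                    Edge G x (vertex P zero) → Edge G y x → Edge G (vertex P (fromℕ m)) y → Cycle G (suc (suc (suc m)))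
insertTwoVertices P {x} {y} x∉P y∉P x≢y x~first y~x last~y =
  close (prepend y (prepend x P x∉P x~first) y∉xP y~x) (s≤s (s≤s (s≤s z≤n))) last~y
  where
  y∉xP : ∀ i → _ ≢ y
  y∉xP zero    = x≢y
  y∉xP (suc i) = y∉P i

-- 2-switches

-- Opaque, so that the vertices in a goal samePair p q u t ≡ b can be inferred by unification.
opaque
  samePair : ∀ {n} → Fin n → Fin n → Fin n → Fin n → Bool
  samePair p q u t = ((p == u) ∧ (q == t)) ∨ ((p == t) ∧ (q == u))

  samePair-refl : ∀ {n} {p q : Fin n} → samePair p q p q ≡ true
  samePair-refl {p = p} {q} rewrite ==-refl p | ==-refl q = refl

  samePair-sym : ∀ {n} {p q u t : Fin n} → samePair p q u t ≡ samePair p q t u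
  samePair-sym {p = p} {q} {u} {t} = ∨-comm ((p == u) ∧ (q == t)) ((p == t) ∧ (q == u))

  samePair-comm : ∀ {n} {p q u t : Fin n} → samePair p q u t ≡ samePair q p u t
  samePair-comm {p = p} {q} {u} {t} rewrite ∧-comm (p == u) (q == t) | ∧-comm (p == t) (q == u) =
    ∨-comm ((q == t) ∧ (p == u)) ((q == u) ∧ (p == t))

  samePair-false : ∀ {n} {p q u t : Fin n} → (u ≡ p → t ≢ q) → (u ≡ q → t ≢ p) → samePair p q u t ≡ false
  samePair-false {p = p} {q} {u} {t} ¬pq ¬qp with p ≟ u | q ≟ t | p ≟ t | q ≟ u
  ... | yes refl | yes refl | _        | _        = ⊥-elim (¬pq refl refl)
  ... | _        | _        | yes refl | yes refl = ⊥-elim (¬qp refl refl)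
  ... | no _     | _        | no _     | _        = refl
  ... | no _     | _        | yes _    | no _     = refl
  ... | yes _    | no _     | no _     | _        = refl
  ... | yes _    | no _     | yes _    | no _     = refl

samePair-u∉ : ∀ {n} {p q u t : Fin n} → u ≢ p → u ≢ q → samePair p q u t ≡ false
samePair-u∉ u≢p u≢q = samePair-false (λ u≡p _ → u≢p u≡p) (λ u≡q _ → u≢q u≡q)

samePair-t∉ : ∀ {n} {p q u t : Fin n} → t ≢ p → t ≢ q → samePair p q u t ≡ false
samePair-t∉ t≢p t≢q = samePair-false (λ _ → t≢q) (λ _ → t≢p)

samePair-p∉ : ∀ {n} {p q u t : Fin n} → p ≢ u → p ≢ t → samePair p q u t ≡ false
samePair-p∉ p≢u p≢t = samePair-false (λ u≡p _ → p≢u (≡-sym u≡p)) (λ _ t≡p → p≢t (≡-sym t≡p))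

samePair-q∉ : ∀ {n} {p q u t : Fin n} → q ≢ u → q ≢ t → samePair p q u t ≡ false
samePair-q∉ q≢u q≢t = samePair-false (λ _ t≡q → q≢t (≡-sym t≡q)) (λ u≡q _ → q≢u (≡-sym u≡q))

samePair-diagonal : ∀ {n} {p q : Fin n} (v : Fin n) → p ≢ q → samePair p q v v ≡ false
samePair-diagonal v p≢q =
  samePair-false (λ v≡p v≡q → p≢q (trans (≡-sym v≡p) v≡q)) (λ v≡q v≡p → p≢q (trans (≡-sym v≡p) v≡q))

record Switch {n} (G : Graph n) : Set where
  field
    a b c d : Fin n
    a~b : Edge G a b
    c~d : Edge G c d
    a≁c : NonEdge G a c
    b≁d : NonEdge G b d
    a≢c : a ≢ c
    a≢d : a ≢ d
    b≢c : b ≢ c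
    b≢d : b ≢ d

override : Bool → Bool → Bool → Bool
override remove add old = if remove then false else (if add then true else old)

module _ {n} {G : Graph n} (s : Switch G) where
  open Switch s

  removed added : Fin n → Fin n → Bool
  removed u t = samePair a b u t ∨ samePair c d u t
  added   u t = samePair a c u t ∨ samePair b d u t

  switch : Graph n
  switch = record
    { adj    = λ u t → override (removed u t) (added u t) (adj G u t)
    ; sym    = sym′
    ; irrefl = irrefl′
    }
    where
    sym′ : ∀ u t → override (removed u t) (added u t) (adj G u t) ≡ override (removed t u) (added t u) (adj G t u)
    sym′ u t rewrite samePair-sym {p = a} {b} {u} {t} | samePair-sym {p = c} {d} {u} {t}
                   | samePair-sym {p = a} {c} {u} {t} | samePair-sym {p = b} {d} {u} {t} | Graph.sym G u t = refl
    irrefl′ : ∀ v → override (removed v v) (added v v) (adj G v v) ≡ false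
    irrefl′ v with removed v v
    ... | true  = refl
    ... | false rewrite samePair-diagonal v a≢c | samePair-diagonal v b≢d = Graph.irrefl G v

  module _ {u t : Fin n} where

    switch-unchanged : removed u t ≡ false → added u t ≡ false → adj switch u t ≡ adj G u t
    switch-unchanged r a rewrite r | a = refl

    switch-keeps-edge : Edge G u t → samePair a b u t ≡ false → samePair c d u t ≡ false → Edge switch u t
    switch-keeps-edge u~t r₁ r₂ rewrite r₁ | r₂ with added u t
    ... | true  = refl
    ... | false = u~t

    switch-keeps-nonEdge : NonEdge G u t → samePair a c u t ≡ false → samePair b d u t ≡ false → NonEdge switch u t
    switch-keeps-nonEdge u≁t a₁ a₂ with removed u t
    ... | true  = refl
    ... | false rewrite a₁ | a₂ = u≁t

    switch-adds-edge : removed u t ≡ false → added u t ≡ true → Edge switch u t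
    switch-adds-edge r a rewrite r | a = refl

  a≢b : a ≢ b
  a≢b = edge⇒≢ G a~b

  c≢d : c ≢ d
  c≢d = edge⇒≢ G c~d

  switch-adds-ac : Edge switch a c
  switch-adds-ac = switch-adds-edge
    (cong₂ _∨_ (samePair-q∉ (a≢b ∘ ≡-sym) b≢c) (samePair-q∉ (a≢d ∘ ≡-sym) (c≢d ∘ ≡-sym)))
    (cong (_∨ samePair b d a c) samePair-refl)

  switch-adds-bd : Edge switch b d
  switch-adds-bd = switch-adds-edge
    (cong₂ _∨_ (samePair-p∉ a≢b a≢d) (samePair-p∉ (b≢c ∘ ≡-sym) c≢d))
    (trans (cong (samePair a c b d ∨_) samePair-refl) (∨-zeroʳ _))

  switch-removes-ab : NonEdge switch a b
  switch-removes-ab rewrite samePair-refl {p = a} {b} = refl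

  degree-switch-a : degree switch a ≡ degree G a
  degree-switch-a = begin
    degree switch a       ≡⟨ degree≡count switch a ⟩
    count (adj switch a)  ≡⟨ count-exchange (b≢c ∘ ≡-sym) a~b a≁c switch-removes-ab switch-adds-ac elsewhere ⟨
    count (adj G a)       ≡⟨ degree≡count G a ⟨
    degree G a ∎
    where
    open ≡-Reasoning
    elsewhere : ∀ u → u ≢ b → u ≢ c → adj G a u ≡ adj switch a u
    elsewhere u u≢b u≢c = ≡-sym (switch-unchanged
      (cong₂ _∨_ (samePair-q∉ (a≢b ∘ ≡-sym) (u≢b ∘ ≡-sym)) (samePair-u∉ a≢c a≢d))
      (cong₂ _∨_ (samePair-q∉ (a≢c ∘ ≡-sym) (u≢c ∘ ≡-sym)) (samePair-u∉ a≢b a≢d)))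

flip turn : ∀ {n} {G : Graph n} → Switch G → Switch G
flip {G = G} s = record
  { a = b ; b = a ; c = d ; d = c ; a~b = edge-sym G a~b ; c~d = edge-sym G c~d ; a≁c = b≁d ; b≁d = a≁c
  ; a≢c = b≢d ; a≢d = b≢c ; b≢c = a≢d ; b≢d = a≢c }
  where open Switch s
turn {G = G} s = record
  { a = c ; b = d ; c = a ; d = b ; a~b = c~d ; c~d = a~b ; a≁c = nonEdge-sym G a≁c ; b≁d = nonEdge-sym G b≁d
  ; a≢c = a≢c ∘ ≡-sym ; a≢d = b≢c ∘ ≡-sym ; b≢c = a≢d ∘ ≡-sym ; b≢d = b≢d ∘ ≡-sym }
  where open Switch s

module _ {n} {G : Graph n} (s : Switch G) (u t : Fin n) where
  open Switch s

  switch-flip : adj (switch (flip s)) u t ≡ adj (switch s) u t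
  switch-flip = cong₂ (λ r a → override r a (adj G u t))
    (cong₂ _∨_ samePair-comm samePair-comm) (∨-comm (samePair b d u t) (samePair a c u t))

  switch-turn : adj (switch (turn s)) u t ≡ adj (switch s) u t
  switch-turn = cong₂ (λ r a → override r a (adj G u t))
    (∨-comm (samePair c d u t) (samePair a b u t)) (cong₂ _∨_ samePair-comm samePair-comm)

degree-cong : ∀ {n} (G H : Graph n) {u} → (∀ t → adj G u t ≡ adj H u t) → degree G u ≡ degree H u
degree-cong G H {u} G≗H = trans (degree≡count G u) (trans (count-cong G≗H) (≡-sym (degree≡count H u)))

-- flip and turn give the same graph, reducing the degrees at b, c and d to the degree at a.
degree-switch : ∀ {n} {G : Graph n} (s : Switch G) u → degree (switch s) u ≡ degree G u
degree-switch {G = G} s u with u ≟ a | u ≟ b | u ≟ c | u ≟ d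
  where open Switch s
... | yes refl | _ | _ | _ = degree-switch-a s
... | _ | yes refl | _ | _ = trans (degree-cong (switch s) (switch (flip s)) (≡-sym ∘ switch-flip s u)) (degree-switch-a (flip s))
... | _ | _ | yes refl | _ = trans (degree-cong (switch s) (switch (turn s)) (≡-sym ∘ switch-turn s u)) (degree-switch-a (turn s))
... | _ | _ | _ | yes refl =
  trans (degree-cong (switch s) (switch (flip (turn s))) (λ t → ≡-sym (trans (switch-flip (turn s) u t) (switch-turn s u t))))
        (degree-switch-a (flip (turn s)))
... | no u≢a | no u≢b | no u≢c | no u≢d = degree-cong (switch s) G λ t →
  switch-unchanged s (cong₂ _∨_ (samePair-u∉ u≢a u≢b) (samePair-u∉ u≢c u≢d))
                     (cong₂ _∨_ (samePair-u∉ u≢a u≢c) (samePair-u∉ u≢b u≢d))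

switch-realizes : ∀ {n} {G : Graph n} {S} (s : Switch G) → Realizes G S → Realizes (switch s) S
switch-realizes s G⊨S u = trans (degree-switch s u) (G⊨S u)

PathAvoids : ∀ {n} {G : Graph n} {ℓ} → Path G ℓ → Fin n → Fin n → Set
PathAvoids P p q = ∀ i j → toℕ j ≡ suc (toℕ i) → samePair p q (vertex P i) (vertex P j) ≡ false

CycleAvoids : ∀ {n} {G : Graph n} {k} → Cycle G k → Fin n → Fin n → Set
CycleAvoids C p q = ∀ i j → CycSucc i j → samePair p q (vtx C i) (vtx C j) ≡ false

pathAvoids-∉ˡ : ∀ {n} {G : Graph n} {ℓ} (P : Path G ℓ) {p} q → NotOnPath P p → PathAvoids P p q
pathAvoids-∉ˡ P q p∉P i j _ = samePair-p∉ (p∉P i ∘ ≡-sym) (p∉P j ∘ ≡-sym)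

pathAvoids-∉ʳ : ∀ {n} {G : Graph n} {ℓ} (P : Path G ℓ) p {q} → NotOnPath P q → PathAvoids P p q
pathAvoids-∉ʳ P p q∉P i j _ = samePair-q∉ (q∉P i ∘ ≡-sym) (q∉P j ∘ ≡-sym)

cycleAvoids-∉ : ∀ {n} {G : Graph n} {k} (C : Cycle G k) {p} q → ¬ OnCycle C p → CycleAvoids C p q
cycleAvoids-∉ C q p∉C i j _ = samePair-p∉ (λ p≡ → p∉C (i , ≡-sym p≡)) (λ p≡ → p∉C (j , ≡-sym p≡))

module _ {n} {G : Graph n} (s : Switch G) where
  open Switch s

  switch-path : ∀ {ℓ} (P : Path G ℓ) → PathAvoids P a b → PathAvoids P c d → Path (switch s) ℓ
  switch-path P avoids-ab avoids-cd = record
    { vertex           = vertex P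
    ; vertex-injective = vertex-injective P
    ; step             = λ i j j≡1+i →
        switch-keeps-edge s (step P i j j≡1+i) (avoids-ab i j j≡1+i) (avoids-cd i j j≡1+i)
    }

  switch-cycle : ∀ {k} (C : Cycle G k) → CycleAvoids C a b → CycleAvoids C c d → Cycle (switch s) k
  switch-cycle C avoids-ab avoids-cd = record
    { len≥3 = len≥3 C
    ; vtx   = vtx C
    ; inj   = inj C
    ; edges = λ i j i→j → switch-keeps-edge s (edges C i j i→j) (avoids-ab i j i→j) (avoids-cd i j i→j)
    }

-- Extending a cycle by one vertex

module _ {n} {G : Graph n} {m} (C : Cycle G (suc m)) where

  first last : Fin n
  first = vtx C zero
  last  = vtx C (fromℕ m)

  last~first : Edge G last first
  last~first = edges C (fromℕ m) zero (inj₂ (cong suc (toℕ-fromℕ m) , refl))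

  last≢first : last ≢ first
  last≢first = edge⇒≢ G last~first

  cycle-path-avoids-closing : PathAvoids (cycle⇒path C) last first
  cycle-path-avoids-closing i j j≡1+i = samePair-false i≢last∨j≢first i≢first∨j≢last
    where
    i≢last∨j≢first : vtx C i ≡ last → vtx C j ≢ first
    i≢last∨j≢first _ cj≡first with () ← trans (≡-sym j≡1+i) (cong toℕ (inj C cj≡first))
    i≢first∨j≢last : vtx C i ≡ first → vtx C j ≢ last
    i≢first∨j≢last ci≡first cj≡last = 3≰2 (subst (λ k → 3 ≤ suc k) m≡1 (len≥3 C))
      where
      3≰2 : ¬ 3 ≤ 2
      3≰2 (s≤s (s≤s ()))
      m≡1 : m ≡ 1
      m≡1 = begin
        m                ≡⟨ toℕ-fromℕ m ⟨
        toℕ (fromℕ m)   ≡⟨ cong toℕ (inj C cj≡last) ⟨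
        toℕ j            ≡⟨ j≡1+i ⟩
        suc (toℕ i)      ≡⟨ cong (suc ∘ toℕ) (inj C ci≡first) ⟩
        1 ∎
        where open ≡-Reasoning

module _ {n} {G : Graph n} {m} (C : Cycle G (suc (suc m))) where

  second penultimate : Fin n
  second      = vtx C (suc zero)
  penultimate = vtx C (inject₁ (fromℕ m))

  penultimate~last : Edge G penultimate (last C)
  penultimate~last = edges C _ _
    (inj₁ (trans (toℕ-fromℕ (suc m)) (cong suc (≡-sym (trans (toℕ-inject₁ (fromℕ m)) (toℕ-fromℕ m))))))

  cycleAvoids-chord : ∀ {z} → z ≢ second → z ≢ last C → CycleAvoids C (first C) z
  cycleAvoids-chord {z} z≢second z≢last i j i→j = samePair-false i≡first⇒j≢z i≡z⇒j≢first
    where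
    i≡first⇒j≢z : vtx C i ≡ first C → vtx C j ≢ z
    i≡first⇒j≢z ci≡first cj≡z with refl ← inj C ci≡first =
      z≢second (trans (≡-sym cj≡z) (cong (vtx C) (CycSucc⇒next i→j)))
    i≡z⇒j≢first : vtx C i ≡ z → vtx C j ≢ first C
    i≡z⇒j≢first ci≡z cj≡first with refl ← inj C cj≡first =
      z≢last (trans (≡-sym ci≡z)
        (cong (vtx C) (next-injective (trans (≡-sym (CycSucc⇒next i→j)) (≡-sym (next-fromℕ (suc m)))))))

¬OnCycle⇒≢ : ∀ {n} {G : Graph n} {k} (C : Cycle G k) {v} → ¬ OnCycle C v → ∀ i → v ≢ vtx C i
¬OnCycle⇒≢ C v∉C i v≡ = v∉C (i , ≡-sym v≡)

¬OnCycle⇒NotOnPath : ∀ {n} {G : Graph n} {k} (C : Cycle G k) {v} → ¬ OnCycle C v → NotOnPath (cycle⇒path C) v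
¬OnCycle⇒NotOnPath C v∉C i eq = v∉C (i , eq)

¬OnCycle⇒NotOnDropLast : ∀ {n} {G : Graph n} {m} (C : Cycle G (suc m)) {v} →
                         ¬ OnCycle C v → NotOnPath (dropLast (cycle⇒path C)) v
¬OnCycle⇒NotOnDropLast C v∉C i eq = v∉C (inject₁ i , eq)

RealizationWithCycle : ∀ {n} → (Fin n → ℕ) → ℕ → Set
RealizationWithCycle {n} S k = Σ (Graph n) λ H → Realizes H S × Cycle H k

module Extension {n} {S : Fin n → ℕ} where

  extend-by-insertion : ∀ {G : Graph n} {m} (G⊨S : Realizes G S) (C : Cycle G (suc m)) {v} → ¬ OnCycle C v →
                        Edge G v (first C) → Edge G (last C) v → RealizationWithCycle S (suc (suc m))
  extend-by-insertion {G} G⊨S C v∉C v~first last~v =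
    G , G⊨S , insertVertex (cycle⇒path C) (m≤n⇒m≤1+n (len≥3 C)) (¬OnCycle⇒NotOnPath C v∉C) v~first last~v

  extend-by-switched-insertion : ∀ {G : Graph n} {m} (G⊨S : Realizes G S) (C : Cycle G (suc m)) {v q} → ¬ OnCycle C v →
    Edge G v (first C) → NonEdge G v (last C) → Edge G v q → q ≢ first C → NonEdge G q (first C) →
    RealizationWithCycle S (suc (suc m))
  extend-by-switched-insertion {G} {m} G⊨S C {v} {q} v∉C v~first v≁last v~q q≢first q≁first =
    switch s , switch-realizes s G⊨S ,
    insertVertex P (m≤n⇒m≤1+n (len≥3 C)) (¬OnCycle⇒NotOnPath C v∉C) v~first′ (edge-sym (switch s) (switch-adds-ac s))
    where
    v≢first : v ≢ first C
    v≢first = ¬OnCycle⇒≢ C v∉C zero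
    v≢last : v ≢ last C
    v≢last = ¬OnCycle⇒≢ C v∉C (fromℕ m)
    q≢last : q ≢ last C
    q≢last refl with () ← trans (≡-sym q≁first) (last~first C)
    s : Switch G
    s = record { a = v ; b = q ; c = last C ; d = first C ; a~b = v~q ; c~d = last~first C ; a≁c = v≁last ; b≁d = q≁first
               ; a≢c = v≢last ; a≢d = v≢first ; b≢c = q≢last ; b≢d = q≢first }
    P : Path (switch s) (suc m)
    P = switch-path s (cycle⇒path C) (pathAvoids-∉ˡ (cycle⇒path C) q (¬OnCycle⇒NotOnPath C v∉C)) (cycle-path-avoids-closing C)
    v~first′ : Edge (switch s) v (first C)
    v~first′ = switch-keeps-edge s v~first
                 (samePair-t∉ (v≢first ∘ ≡-sym) (q≢first ∘ ≡-sym)) (samePair-u∉ v≢last v≢first)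

  extend-via-neighbour : ∀ {G : Graph n} {m} (G⊨S : Realizes G S) (C : Cycle G (suc m)) {v q} → ¬ OnCycle C v →
    Edge G v (first C) → Edge G v q → q ≢ first C → NonEdge G q (first C) → RealizationWithCycle S (suc (suc m))
  extend-via-neighbour {G} G⊨S C {v} v∉C v~first v~q q≢first q≁first with adj G v (last C) in v~last
  ... | true  = extend-by-insertion G⊨S C v∉C v~first (edge-sym G v~last)
  ... | false = extend-by-switched-insertion G⊨S C v∉C v~first v~last v~q q≢first q≁first

  extend-by-replacement : ∀ {G : Graph n} {m} (G⊨S : Realizes G S) (C : Cycle G (suc (suc m))) {x y} →
    ¬ OnCycle C x → ¬ OnCycle C y → x ≢ y →
    Edge G x (first C) → Edge G y x → Edge G (penultimate C) y → RealizationWithCycle S (suc (suc (suc m)))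
  extend-by-replacement {G} G⊨S C x∉C y∉C x≢y x~first y~x penultimate~y =
    G , G⊨S , insertTwoVertices (dropLast (cycle⇒path C))
                (¬OnCycle⇒NotOnDropLast C x∉C) (¬OnCycle⇒NotOnDropLast C y∉C)
                x≢y x~first y~x penultimate~y

  extend-by-switched-replacement : ∀ {G : Graph n} {m} (G⊨S : Realizes G S) (C : Cycle G (suc (suc m))) {x y p} →
    ¬ OnCycle C x → ¬ OnCycle C y → ¬ OnCycle C p → x ≢ y → p ≢ x →
    Edge G x (first C) → Edge G x y → NonEdge G y (penultimate C) → Edge G y p → NonEdge G p (last C) →
    RealizationWithCycle S (suc (suc (suc m)))
  extend-by-switched-replacement {G} {m} G⊨S C {x} {y} {p} x∉C y∉C p∉C x≢y p≢x x~first x~y y≁penultimate y~p p≁last =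
    switch s , switch-realizes s G⊨S ,
    insertTwoVertices Q (¬OnCycle⇒NotOnDropLast C x∉C) (¬OnCycle⇒NotOnDropLast C y∉C)
      x≢y x~first′ y~x′ (edge-sym (switch s) (switch-adds-ac s))
    where
    s : Switch G
    s = record { a = y ; b = p ; c = penultimate C ; d = last C ; a~b = y~p ; c~d = penultimate~last C
               ; a≁c = y≁penultimate ; b≁d = p≁last
               ; a≢c = ¬OnCycle⇒≢ C y∉C _ ; a≢d = ¬OnCycle⇒≢ C y∉C _
               ; b≢c = ¬OnCycle⇒≢ C p∉C _ ; b≢d = ¬OnCycle⇒≢ C p∉C _ }
    Q₀ : Path G (suc m)
    Q₀ = dropLast (cycle⇒path C)
    last∉Q : NotOnPath Q₀ (last C)
    last∉Q i eq = fromℕ≢inject₁ (≡-sym (inj C eq))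
    Q : Path (switch s) (suc m)
    Q = switch-path s Q₀
          (pathAvoids-∉ˡ Q₀ p (¬OnCycle⇒NotOnDropLast C y∉C)) (pathAvoids-∉ʳ Q₀ (penultimate C) last∉Q)
    x~first′ : Edge (switch s) x (first C)
    x~first′ = switch-keeps-edge s x~first (samePair-u∉ x≢y (p≢x ∘ ≡-sym))
                 (samePair-u∉ (¬OnCycle⇒≢ C x∉C (inject₁ (fromℕ m))) (¬OnCycle⇒≢ C x∉C (fromℕ (suc m))))
    y~x′ : Edge (switch s) y x
    y~x′ = switch-keeps-edge s (edge-sym G x~y) (samePair-q∉ (edge⇒≢ G y~p ∘ ≡-sym) p≢x)
             (samePair-u∉ (¬OnCycle⇒≢ C y∉C (inject₁ (fromℕ m))) (¬OnCycle⇒≢ C y∉C (fromℕ (suc m))))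

  extend-by-double-switch : ∀ {G : Graph n} {m} (G⊨S : Realizes G S) (C : Cycle G (suc m)) {x y₁ y₂} →
    ¬ OnCycle C x → ¬ OnCycle C y₁ → ¬ OnCycle C y₂ → y₁ ≢ y₂ →
    NonEdge G x (last C) → NonEdge G x (first C) → Edge G x y₁ → Edge G x y₂ → NonEdge G y₁ y₂ →
    NonEdge G y₁ (first C) → RealizationWithCycle S (suc (suc m))
  extend-by-double-switch {G} {m} G⊨S C {x} {y₁} {y₂}
                          x∉C y₁∉C y₂∉C y₁≢y₂ x≁last x≁first x~y₁ x~y₂ y₁≁y₂ y₁≁first =
    switch s₂ , switch-realizes s₂ (switch-realizes s₁ G⊨S) ,
    insertVertex P₂ (m≤n⇒m≤1+n (len≥3 C)) (¬OnCycle⇒NotOnPath C x∉C) (switch-adds-ac s₂) last~x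
    where
    x≢first : x ≢ first C
    x≢first = ¬OnCycle⇒≢ C x∉C zero
    x≢last : x ≢ last C
    x≢last = ¬OnCycle⇒≢ C x∉C (fromℕ m)
    y₁≢first : y₁ ≢ first C
    y₁≢first = ¬OnCycle⇒≢ C y₁∉C zero
    y₁≢last : y₁ ≢ last C
    y₁≢last = ¬OnCycle⇒≢ C y₁∉C (fromℕ m)
    y₂≢first : y₂ ≢ first C
    y₂≢first = ¬OnCycle⇒≢ C y₂∉C zero
    y₂≢last : y₂ ≢ last C
    y₂≢last = ¬OnCycle⇒≢ C y₂∉C (fromℕ m)
    x≢y₁ : x ≢ y₁
    x≢y₁ = edge⇒≢ G x~y₁
    x≢y₂ : x ≢ y₂
    x≢y₂ = edge⇒≢ G x~y₂
    -- Together the two switches trade x y₁, x y₂, last first for x last, x first, y₁ y₂.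
    s₁ : Switch G
    s₁ = record { a = x ; b = y₁ ; c = last C ; d = first C ; a~b = x~y₁ ; c~d = last~first C
                ; a≁c = x≁last ; b≁d = y₁≁first
                ; a≢c = x≢last ; a≢d = x≢first ; b≢c = y₁≢last ; b≢d = y₁≢first }
    H₁ : Graph n
    H₁ = switch s₁
    s₂ : Switch H₁
    s₂ = record
      { a = x ; b = y₂ ; c = first C ; d = y₁
      ; a~b = switch-keeps-edge s₁ x~y₂ (samePair-q∉ (x≢y₁ ∘ ≡-sym) y₁≢y₂) (samePair-u∉ x≢last x≢first)
      ; c~d = edge-sym H₁ (switch-adds-bd s₁)
      ; a≁c = switch-keeps-nonEdge s₁ x≁first
                (samePair-q∉ (x≢last ∘ ≡-sym) (last≢first C)) (samePair-u∉ x≢y₁ x≢first)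
      ; b≁d = switch-keeps-nonEdge s₁ (nonEdge-sym G y₁≁y₂)
                (samePair-u∉ (x≢y₂ ∘ ≡-sym) y₂≢last) (samePair-u∉ (y₁≢y₂ ∘ ≡-sym) y₂≢first)
      ; a≢c = x≢first ; a≢d = x≢y₁ ; b≢c = y₂≢first ; b≢d = y₁≢y₂ ∘ ≡-sym }
    P₂ : Path (switch s₂) (suc m)
    P₂ = switch-path s₂ P₁ (pathAvoids-∉ˡ P₁ y₂ (¬OnCycle⇒NotOnPath C x∉C))
                           (pathAvoids-∉ʳ P₁ (first C) (¬OnCycle⇒NotOnPath C y₁∉C))
      where
      P₁ : Path H₁ (suc m)
      P₁ = switch-path s₁ (cycle⇒path C) (pathAvoids-∉ˡ (cycle⇒path C) y₁ (¬OnCycle⇒NotOnPath C x∉C))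
                                         (cycle-path-avoids-closing C)
    last~x : Edge (switch s₂) (last C) x
    last~x = switch-keeps-edge s₂ (edge-sym H₁ (switch-adds-ac s₁))
               (samePair-u∉ (x≢last ∘ ≡-sym) (y₂≢last ∘ ≡-sym)) (samePair-u∉ (last≢first C) (y₁≢last ∘ ≡-sym))

  extend-by-switch-at-first : ∀ {G : Graph n} {m} (G⊨S : Realizes G S) (C : Cycle G (suc (suc m))) {x y z q} → ¬ OnCycle C x →
    NonEdge G x (first C) → Edge G x y → Edge G (first C) z → z ≢ second C → z ≢ last C → y ≢ z → NonEdge G y z →
    Edge G x q → q ≢ y → q ≢ first C → NonEdge G q (first C) → RealizationWithCycle S (suc (suc (suc m)))
  extend-by-switch-at-first {G} {m} G⊨S C {x} {y} {z} {q}
                            x∉C x≁first x~y first~z z≢second z≢last y≢z y≁z x~q q≢y q≢first q≁first =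
    extend-via-neighbour (switch-realizes s G⊨S) C₁ x∉C (switch-adds-ac s) x~q′ q≢first q≁first′
    where
    x≢first : x ≢ first C
    x≢first = ¬OnCycle⇒≢ C x∉C zero
    x≢z : x ≢ z
    x≢z refl with () ← trans (≡-sym x≁first) (edge-sym G first~z)
    y≢first : y ≢ first C
    y≢first refl with () ← trans (≡-sym x≁first) x~y
    s : Switch G
    s = record { a = x ; b = y ; c = first C ; d = z ; a~b = x~y ; c~d = first~z ; a≁c = x≁first ; b≁d = y≁z
               ; a≢c = x≢first ; a≢d = x≢z ; b≢c = y≢first ; b≢d = y≢z }
    C₁ : Cycle (switch s) (suc (suc m))
    C₁ = switch-cycle s C (cycleAvoids-∉ C y x∉C) (cycleAvoids-chord C z≢second z≢last)
    x~q′ : Edge (switch s) x q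
    x~q′ = switch-keeps-edge s x~q (samePair-q∉ (edge⇒≢ G x~y ∘ ≡-sym) (q≢y ∘ ≡-sym)) (samePair-u∉ x≢first x≢z)
    q≁first′ : NonEdge (switch s) q (first C)
    q≁first′ = switch-keeps-nonEdge s q≁first
                 (samePair-p∉ (edge⇒≢ G x~q) x≢first) (samePair-t∉ (y≢first ∘ ≡-sym) (edge⇒≢ G first~z))

OnCycle⇒inImage : ∀ {n} {G : Graph n} {k} (C : Cycle G k) {u} → OnCycle C u → inImage (vtx C) u ≡ true
OnCycle⇒inImage C {u} = dec-true (any? λ i → vtx C i ≟ u)

degree≤on+off : ∀ {n} {G : Graph n} {k} (C : Cycle G k) x →
                degree G x ≤ count (adj G x ∘ vtx C) + count (λ u → adj G x u ∧ not (inImage (vtx C) u))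
degree≤on+off {G = G} C x = begin
  degree G x                                                      ≡⟨ degree≡count G x ⟩
  count (adj G x)                                                 ≡⟨ count-cong (λ u → split (adj G x u) (inImage (vtx C) u)) ⟩
  count (λ u → (adj G x u ∧ inImage (vtx C) u) ∨ (adj G x u ∧ not (inImage (vtx C) u)))
                                                                  ≤⟨ count-∨ (λ u → adj G x u ∧ inImage (vtx C) u) _ ⟩
  count (λ u → adj G x u ∧ inImage (vtx C) u) + count (λ u → adj G x u ∧ not (inImage (vtx C) u))
                                                                  ≤⟨ +-monoˡ-≤ _ (count-image (adj G x) (vtx C)) ⟩
  count (adj G x ∘ vtx C) + count (λ u → adj G x u ∧ not (inImage (vtx C) u)) ∎
  where
  open ≤-Reasoning
  split : ∀ a b → a ≡ (a ∧ b) ∨ (a ∧ not b)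
  split true  true  = refl
  split true  false = refl
  split false b     = refl

≤⌊/2⌋+⌊/2⌋+1 : ∀ k → k ≤ k / 2 + k / 2 + 1
≤⌊/2⌋+⌊/2⌋+1 k = begin
  k                       ≡⟨ m≡m%n+[m/n]*n k 2 ⟩
  k % 2 + (k / 2) * 2     ≤⟨ +-monoˡ-≤ ((k / 2) * 2) (≤-pred (m%n<n k 2)) ⟩
  1 + (k / 2) * 2         ≡⟨ rearrange (k / 2) ⟩
  k / 2 + k / 2 + 1 ∎
  where
  open ≤-Reasoning
  rearrange : ∀ h → 1 + h * 2 ≡ h + h + 1
  rearrange = solve-∀

neighbour-avoiding : ∀ {n} (G : Graph n) {u} → 3 ≤ degree G u → ∀ a b → ∃ λ z → Edge G u z × z ≢ a × z ≢ b
neighbour-avoiding G {u} 3≤deg a b with any? (λ z → (adj G u z ≟ᵇ true) ×-dec (¬? (z ≟ a) ×-dec ¬? (z ≟ b)))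
... | yes found = found
... | no  none  = ⊥-elim (<⇒≱ 3≤deg (subst (_≤ 2) (≡-sym (degree≡count G u)) (count≤2 a b only-ab)))
  where
  only-ab : ∀ z → adj G u z ≡ true → z ≡ a ⊎ z ≡ b
  only-ab z u~z with z ≟ a | z ≟ b
  ... | yes z≡a | _       = inj₁ z≡a
  ... | no _    | yes z≡b = inj₂ z≡b
  ... | no z≢a  | no z≢b  = ⊥-elim (none (z , u~z , z≢a , z≢b))

¬2[h+1]≤2h+1 : ∀ {h c k} → h + 1 ≤ c → c + c ≤ k → k ≤ h + h + 1 → ⊥
¬2[h+1]≤2h+1 {h} h+1≤c c+c≤k k≤2h+1 =
  <-irrefl refl (subst (_≤ h + h + 1) (regroup h) (≤-trans (+-mono-≤ h+1≤c h+1≤c) (≤-trans c+c≤k k≤2h+1)))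
  where
  regroup : ∀ h → (h + 1) + (h + 1) ≡ suc (h + h + 1)
  regroup = solve-∀

¬3h≤2h+1 : ∀ {h c k} → 2 ≤ h → h ≤ c → c + c + c ≤ k → k ≤ h + h + 1 → ⊥
¬3h≤2h+1 {h} 2≤h h≤c 3c≤k k≤2h+1 =
  <⇒≱ 2≤h (+-cancelˡ-≤ (h + h) h 1 (≤-trans (+-mono-≤ (+-mono-≤ h≤c h≤c) h≤c) (≤-trans 3c≤k k≤2h+1)))

module LongerCycle {n} {S : Fin n → ℕ} {m} {G : Graph n} (G⊨S : Realizes G S)
             (C : Cycle G (suc (suc (suc (suc m))))) {x : Fin n} (x∉C : ¬ OnCycle C x)
             (deg-x : suc (suc (suc (suc m))) / 2 + 1 ≤ degree G x) where

  open Extension {S = S}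

  k : ℕ
  k = suc (suc (suc (suc m)))

  Goal : Set
  Goal = RealizationWithCycle S (suc k)

  c : Fin k → Fin n
  c = vtx C

  edge? : ∀ u v → Dec (Edge G u v)
  edge? u v = adj G u v ≟ᵇ true

  onCycle? : ∀ u → Dec (OnCycle C u)
  onCycle? u = any? λ i → c i ≟ u

  ≢c : ∀ {v} → ¬ OnCycle C v → ∀ i → v ≢ c i
  ≢c = ¬OnCycle⇒≢ C

  toFirst : ∀ r (P : Fin n → Set) → P (c r) → P (first (rotate C r))
  toFirst r P = subst P (≡-sym (first-rotate C r))

  insert-after : ∀ i {v} → ¬ OnCycle C v → Edge G (c i) v → Edge G v (c (next i)) → Goal
  insert-after i {v} v∉C ci~v v~ci⁺ =
    extend-by-insertion G⊨S (rotate C (next i)) (¬OnCycle-rotate C (next i) v∉C)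
      (toFirst (next i) (Edge G v) v~ci⁺) (subst (λ u → Edge G u v) (≡-sym (last-rotate-next C i)) ci~v)

  via-neighbour-at : ∀ i {v q} → ¬ OnCycle C v → Edge G v (c i) → Edge G v q → q ≢ c i → NonEdge G q (c i) → Goal
  via-neighbour-at i {v} {q} v∉C v~ci v~q q≢ci q≁ci =
    extend-via-neighbour G⊨S (rotate C i) (¬OnCycle-rotate C i v∉C)
      (toFirst i (Edge G v) v~ci) v~q (toFirst i (q ≢_) q≢ci) (toFirst i (NonEdge G q) q≁ci)

  replace-between : ∀ i {y} → ¬ OnCycle C y → Edge G x (c (next (next i))) → Edge G y x → Edge G (c i) y → Goal
  replace-between i {y} y∉C x~ci⁺⁺ y~x ci~y =
    extend-by-replacement G⊨S (rotate C (next (next i)))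
      (¬OnCycle-rotate C (next (next i)) x∉C) (¬OnCycle-rotate C (next (next i)) y∉C)
      (edge⇒≢ G y~x ∘ ≡-sym) (toFirst (next (next i)) (Edge G x) x~ci⁺⁺) y~x
      (subst (λ u → Edge G u y) (≡-sym (penultimate-rotate-next² C i)) ci~y)

  double-switch-after : ∀ i {y₁ y₂} → ¬ OnCycle C y₁ → ¬ OnCycle C y₂ → y₁ ≢ y₂ →
    NonEdge G x (c i) → NonEdge G x (c (next i)) → Edge G x y₁ → Edge G x y₂ → NonEdge G y₁ y₂ →
    NonEdge G y₁ (c (next i)) → Goal
  double-switch-after i {y₁} y₁∉C y₂∉C y₁≢y₂ x≁ci x≁ci⁺ x~y₁ x~y₂ y₁≁y₂ y₁≁ci⁺ =
    extend-by-double-switch G⊨S (rotate C (next i)) (¬OnCycle-rotate C (next i) x∉C) (¬OnCycle-rotate C (next i) y₁∉C)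
      (¬OnCycle-rotate C (next i) y₂∉C) y₁≢y₂ (subst (NonEdge G x) (≡-sym (last-rotate-next C i)) x≁ci)
      (toFirst (next i) (NonEdge G x) x≁ci⁺) x~y₁ x~y₂ y₁≁y₂ (toFirst (next i) (NonEdge G y₁) y₁≁ci⁺)

  nonEdge? : ∀ u v → Dec (NonEdge G u v)
  nonEdge? u v = adj G u v ≟ᵇ false

  Independent 2-Independent Dominated : Set
  Independent   = ∀ i → Edge G x (c i) → NonEdge G x (c (next i))
  2-Independent = ∀ i → Edge G x (c i) → NonEdge G x (c (next (next i)))
  Dominated     = ∀ i {q} → Edge G x (c i) → Edge G x q → q ≢ c i → Edge G q (c i)

  ¬consecutive⇒independent : ¬ ∃ (λ i → Edge G x (c i) × Edge G x (c (next i))) → Independent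
  ¬consecutive⇒independent none i x~ci = ¬edge⇒nonEdge G λ x~ci⁺ → none (i , x~ci , x~ci⁺)

  ¬distance-two⇒2-independent : ¬ ∃ (λ i → Edge G x (c i) × Edge G x (c (next (next i)))) → 2-Independent
  ¬distance-two⇒2-independent none i x~ci = ¬edge⇒nonEdge G λ x~ci⁺⁺ → none (i , x~ci , x~ci⁺⁺)

  ¬undominated⇒dominated : ¬ ∃ (λ i → ∃ λ q → Edge G x (c i) × Edge G x q × q ≢ c i × NonEdge G q (c i)) → Dominated
  ¬undominated⇒dominated none i {q} x~ci x~q q≢ci with adj G q (c i) in q~ci
  ... | true  = refl
  ... | false = ⊥-elim (none (i , q , x~ci , x~q , q≢ci , q~ci))

  half : ℕ
  half = k / 2

  2≤half : 2 ≤ half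
  2≤half = /-monoˡ-≤ {m = 4} {n = k} 2 (s≤s (s≤s (s≤s (s≤s z≤n))))

  3≤deg-x : 3 ≤ degree G x
  3≤deg-x = ≤-trans (+-monoˡ-≤ 1 2≤half) deg-x

  off-cycle : Fin n → Bool
  off-cycle u = adj G x u ∧ not (inImage c u)

  off-cycle-false : ∀ u → (Edge G x u → OnCycle C u) → off-cycle u ≡ false
  off-cycle-false u on with adj G x u
  ... | false = refl
  ... | true  = cong (λ b → true ∧ not b) (OnCycle⇒inImage C (on refl))

  off-cycle-true : ∀ {u} → off-cycle u ≡ true → Edge G x u × ¬ OnCycle C u
  off-cycle-true {u} off with adj G x u
  ... | true = refl , λ on → contradiction (trans (≡-sym off) (cong (λ b → true ∧ not b) (OnCycle⇒inImage C on))) λ ()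

  degree-bound : half + 1 ≤ count (adj G x ∘ c) + count off-cycle
  degree-bound = ≤-trans deg-x (degree≤on+off C x)

  off-cycle-neighbour : Independent → ∃ λ y → Edge G x y × ¬ OnCycle C y
  off-cycle-neighbour indep with any? (λ y → edge? x y ×-dec ¬? (onCycle? y))
  ... | yes found = found
  ... | no  none  = ⊥-elim (¬2[h+1]≤2h+1 h+1≤nbrs (count-independent (adj G x ∘ c) indep) (≤⌊/2⌋+⌊/2⌋+1 k))
    where
    on : ∀ {u} → Edge G x u → OnCycle C u
    on {u} x~u with onCycle? u
    ... | yes u∈C = u∈C
    ... | no  u∉C = ⊥-elim (none (u , x~u , u∉C))
    h+1≤nbrs : half + 1 ≤ count (adj G x ∘ c)
    h+1≤nbrs = subst (half + 1 ≤_)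
                 (trans (cong (count (adj G x ∘ c) +_) (count-false λ u → off-cycle-false u on)) (+-identityʳ _))
                 degree-bound

  another-off-cycle-neighbour : Independent → 2-Independent → ∀ y → ∃ λ y₂ → Edge G x y₂ × ¬ OnCycle C y₂ × y₂ ≢ y
  another-off-cycle-neighbour indep indep₂ y with any? (λ y₂ → edge? x y₂ ×-dec (¬? (onCycle? y₂) ×-dec ¬? (y₂ ≟ y)))
  ... | yes found = found
  ... | no  none  = ⊥-elim (¬3h≤2h+1 2≤half h≤nbrs (count-2-independent (adj G x ∘ c) indep indep₂) (≤⌊/2⌋+⌊/2⌋+1 k))
    where
    only-y : ∀ u → off-cycle u ≡ true → u ≡ y
    only-y u off with off-cycle-true off | u ≟ y
    ... | _             | yes u≡y = u≡y
    ... | x~u , u∉C     | no  u≢y = ⊥-elim (none (u , x~u , u∉C , u≢y))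
    h≤nbrs : half ≤ count (adj G x ∘ c)
    h≤nbrs = +-cancelʳ-≤ 1 half _ (≤-trans degree-bound (+-monoʳ-≤ _ (count-at-most-one y only-y)))

  -- The rotation C′ starts at c i₀, so its last and penultimate vertices are c (i₀ − 1) and c (i₀ − 2).
  module _ (i₀ : Fin k) (x~ci₀ : Edge G x (c i₀)) where

    C′ : Cycle G k
    C′ = rotate C i₀

    x~first′ : Edge G x (first C′)
    x~first′ = toFirst i₀ (Edge G x) x~ci₀

    extend-via-second-neighbour : ∀ {y p} → ¬ OnCycle C y → ¬ OnCycle C p → Edge G x y → p ≢ x →
      NonEdge G y (penultimate C′) → Edge G y p → Edge G p (c i₀) → Goal
    extend-via-second-neighbour {y} {p} y∉C p∉C x~y p≢x y≁penultimate y~p p~ci₀ with edge? p (last C′)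
    ... | yes p~last = extend-by-insertion G⊨S C′ (¬OnCycle-rotate C i₀ p∉C) (toFirst i₀ (Edge G p) p~ci₀) (edge-sym G p~last)
    ... | no  p≁last = extend-by-switched-replacement G⊨S C′ (¬OnCycle-rotate C i₀ x∉C) (¬OnCycle-rotate C i₀ y∉C)
                         (¬OnCycle-rotate C i₀ p∉C) (edge⇒≢ G x~y) p≢x x~first′ x~y y≁penultimate y~p
                         (¬edge⇒nonEdge G p≁last)

    extend-via-dominated-neighbour : Independent → 2-Independent → ∀ {y} → Edge G x y → ¬ OnCycle C y →
      (∀ {q} → Edge G y q → q ≢ c i₀ → Edge G q (c i₀)) → Goal
    extend-via-dominated-neighbour indep indep₂ {y} x~y y∉C y-dominated with edge? (penultimate C′) y
    ... | yes penultimate~y = extend-by-replacement G⊨S C′ (¬OnCycle-rotate C i₀ x∉C) (¬OnCycle-rotate C i₀ y∉C)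
                                (edge⇒≢ G x~y) x~first′ (edge-sym G x~y) penultimate~y
    ... | no  penultimate≁y with any? (λ p → edge? y p ×-dec (¬? (onCycle? p) ×-dec ¬? (p ≟ x)))
    ... | yes (p , y~p , p∉C , p≢x) = extend-via-second-neighbour y∉C p∉C x~y p≢x
                                        (nonEdge-sym G (¬edge⇒nonEdge G penultimate≁y)) y~p (y-dominated y~p (≢c p∉C i₀))
    ... | no  none with another-off-cycle-neighbour indep indep₂ y | edge? y (c (next (next i₀)))
    ... | _ | yes y~ci₀⁺⁺ =
      via-neighbour-at (next (next i₀)) y∉C y~ci₀⁺⁺ (edge-sym G x~y) (≢c x∉C _) (indep₂ i₀ x~ci₀)
    ... | y₂ , x~y₂ , y₂∉C , y₂≢y | no y≁ci₀⁺⁺ =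
      double-switch-after (next i₀) y∉C y₂∉C (y₂≢y ∘ ≡-sym) (indep i₀ x~ci₀) (indep₂ i₀ x~ci₀) x~y x~y₂
        (¬edge⇒nonEdge G λ y~y₂ → none (y₂ , y~y₂ , y₂∉C , edge⇒≢ G x~y₂ ∘ ≡-sym))
        (¬edge⇒nonEdge G y≁ci₀⁺⁺)

    extend-via-off-cycle-neighbour : Independent → 2-Independent → ∀ {y} → Edge G x y → ¬ OnCycle C y →
      Edge G y (c i₀) → Goal
    extend-via-off-cycle-neighbour indep indep₂ {y} x~y y∉C y~ci₀
      with any? (λ q → edge? y q ×-dec (¬? (q ≟ c i₀) ×-dec nonEdge? q (c i₀)))
    ... | yes (q , y~q , q≢ci₀ , q≁ci₀) = via-neighbour-at i₀ y∉C y~ci₀ y~q q≢ci₀ q≁ci₀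
    ... | no  none = extend-via-dominated-neighbour indep indep₂ x~y y∉C y-dominated
      where
      y-dominated : ∀ {q} → Edge G y q → q ≢ c i₀ → Edge G q (c i₀)
      y-dominated {q} y~q q≢ci₀ with adj G q (c i₀) in q~ci₀
      ... | true  = refl
      ... | false = ⊥-elim (none (q , y~q , q≢ci₀ , q~ci₀))

  neighbour-on-cycle : ∀ i₀ → Edge G x (c i₀) → Goal
  neighbour-on-cycle i₀ x~ci₀ with any? (λ i → edge? x (c i) ×-dec edge? x (c (next i)))
  ... | yes (i , x~ci , x~ci⁺) = insert-after i x∉C (edge-sym G x~ci) x~ci⁺
  ... | no  consecutive
    with any? (λ i → any? λ q → edge? x (c i) ×-dec (edge? x q ×-dec (¬? (q ≟ c i) ×-dec nonEdge? q (c i))))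
  ... | yes (i , q , x~ci , x~q , q≢ci , q≁ci) = via-neighbour-at i x∉C x~ci x~q q≢ci q≁ci
  ... | no  undominated with off-cycle-neighbour (¬consecutive⇒independent consecutive)
  ... | y , x~y , y∉C with any? (λ i → edge? x (c i) ×-dec edge? x (c (next (next i))))
  ... | yes (i , x~ci , x~ci⁺⁺) =
    replace-between i y∉C x~ci⁺⁺ (edge-sym G x~y) (edge-sym G (¬undominated⇒dominated undominated i x~ci x~y (≢c y∉C i)))
  ... | no  distance-two =
    extend-via-off-cycle-neighbour i₀ x~ci₀
      (¬consecutive⇒independent consecutive) (¬distance-two⇒2-independent distance-two) x~y y∉C
      (¬undominated⇒dominated undominated i₀ x~ci₀ x~y (≢c y∉C i₀))

  neighbour∉C : (∀ i → NonEdge G x (c i)) → ∀ {y} → Edge G x y → ¬ OnCycle C y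
  neighbour∉C x≁C x~y (i , refl) with () ← trans (≡-sym (x≁C i)) x~y

  far-from-cycle : (∀ i → NonEdge G x (c i)) → (∀ i {y} → Edge G x y → NonEdge G y (c i)) →
                   ∀ j → 3 ≤ degree G (c j) → Goal
  far-from-cycle x≁C nbrs≁C j deg-cj
    with neighbour-avoiding G (toFirst j (λ u → 3 ≤ degree G u) deg-cj) (second (rotate C j)) (last (rotate C j))
       | neighbour-avoiding G 3≤deg-x x x
  ... | z , first~z , z≢second , z≢last | y , x~y , _
    with neighbour-avoiding G 3≤deg-x y y | edge? y z
  ... | _ | yes y~z =
    extend-via-neighbour G⊨S (rotate C j) z∉C (edge-sym G first~z) (edge-sym G y~z) (≢c (neighbour∉C x≁C x~y) _) (nbrs≁C _ x~y)
    where
    z∉C : ¬ OnCycle (rotate C j) z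
    z∉C (i , refl) with () ← trans (≡-sym (nbrs≁C (shift j i) x~y)) y~z
  ... | q , x~q , q≢y , _ | no y≁z =
    extend-by-switch-at-first G⊨S (rotate C j) (¬OnCycle-rotate C j x∉C) (x≁C _) x~y first~z z≢second z≢last y≢z
      (¬edge⇒nonEdge G y≁z) x~q q≢y (≢c (neighbour∉C x≁C x~q) _) (nbrs≁C _ x~q)
    where
    y≢z : y ≢ z
    y≢z refl with () ← trans (≡-sym (nbrs≁C (shift j zero) x~y)) (edge-sym G first~z)

  no-neighbour-on-cycle : (∀ i → NonEdge G x (c i)) → ∀ j → 3 ≤ degree G (c j) → Goal
  no-neighbour-on-cycle x≁C j deg-cj with any? (λ y → any? λ i → edge? x y ×-dec edge? y (c i))
  ... | yes (y , i , x~y , y~ci) = via-neighbour-at i (neighbour∉C x≁C x~y) y~ci (edge-sym G x~y) (≢c x∉C i) (x≁C i)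
  ... | no  none = far-from-cycle x≁C (λ i x~y → ¬edge⇒nonEdge G λ y~ci → none (_ , i , x~y , y~ci)) j deg-cj

  extend : ∀ j → 3 ≤ degree G (c j) → Goal
  extend j deg-cj with any? (λ i → edge? x (c i))
  ... | yes (i₀ , x~ci₀) = neighbour-on-cycle i₀ x~ci₀
  ... | no  none         = no-neighbour-on-cycle (λ i → ¬edge⇒nonEdge G (none ∘ (i ,_))) j deg-cj

theorem1 : (k n : ℕ) → 4 ≤ k → (S : Fin n → ℕ)
    → (G : Graph n) → Realizes G S → (C : Cycle G k)
    → (x : Fin n) → ¬ OnCycle C x → (k / 2) + 1 ≤ degree G x
    → (w : Fin n) → OnCycle C w → 3 ≤ degree G w
    → Σ (Graph n) (λ H → Realizes H S × Cycle H (suc k))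
theorem1 .(suc (suc (suc (suc _)))) n (s≤s (s≤s (s≤s (s≤s z≤n)))) S G G⊨S C x x∉C deg-x w (j , cj≡w) deg-w =
  LongerCycle.extend G⊨S C x∉C deg-x j (subst (λ u → 3 ≤ degree G u) (≡-sym cj≡w) deg-w)
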